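{- Let $G$ be a graph with vertex cover number $k$ that admits a proper weight function $w:E(G)\to\{0,1\}$. Then there exists a proper weight function $\hat w:E(G)\to\{0,1\}$ such that $\mathrm{color}_{\hat w}(v)\le 8k^2+8k$ for every vertex $v\in V(G)$.
   Context: All graphs are finite, simple, undirected, and have no isolated edges. For $w:E(G)\to\{0,1\}$, $\mathrm{color}_w(v)=\sum_{e\ni v}w(e)$; $w$ is proper if $\mathrm{color}_w(u)\neq\mathrm{color}_w(v)$ for every edge $uv\in E(G)$. -}

module Defs where

open import Data.Nat using (ℕ; zero; suc; _+_; _*_; _≤_)
open import Data.Fin using (Fin; zero; suc; toℕ)
open import Data.Bool using (Bool; true; false; T; if_then_else_)
open import Data.Product using (_×_; _,_; proj₁; proj₂; Σ; ∃)
open import Data.Sum using (_⊎_)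
open import Data.Empty using (⊥)
open import Relation.Nullary using (¬_)
open import Relation.Binary.PropositionalEquality using (_≡_; _≢_)
open import Data.Fin.Properties using (_≟_)
open import Relation.Nullary.Decidable using (⌊_⌋)

Σᶠ : ∀ {m} → (Fin m → ℕ) → ℕ
Σᶠ {zero} f = 0
Σᶠ {suc m} f = f zero + Σᶠ {m} (λ i → f (suc i))

record Graph : Set where
  field
    n     : ℕ
    m     : ℕ
    ends  : Fin m → Fin n × Fin n
    loopless : ∀ e → proj₁ (ends e) ≢ proj₂ (ends e)
    simple : ∀ e f → (proj₁ (ends e) ≡ proj₁ (ends f) × proj₂ (ends e) ≡ proj₂ (ends f))
                   ⊎ (proj₁ (ends e) ≡ proj₂ (ends f) × proj₂ (ends e) ≡ proj₁ (ends f))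
                   → e ≡ f

open Graph public

inc : (G : Graph) → Fin (m G) → Fin (n G) → ℕ
inc G e v with ⌊ proj₁ (ends G e) ≟ v ⌋ | ⌊ proj₂ (ends G e) ≟ v ⌋
... | false | false = 0
... | _ | _ = 1

degree : (G : Graph) → Fin (n G) → ℕ
degree G v = Σᶠ (λ e → inc G e v)

NoIsolatedEdges : Graph → Set
NoIsolatedEdges G = ∀ e → ¬ (degree G (proj₁ (ends G e)) ≡ 1 × degree G (proj₂ (ends G e)) ≡ 1)

Weight : Graph → Set
Weight G = Fin (m G) → Fin 2

toℕ₂ : Fin 2 → ℕ
toℕ₂ = toℕ

color : (G : Graph) → Weight G → Fin (n G) → ℕ
color G w v = Σᶠ (λ e → inc G e v * toℕ₂ (w e))

Proper : (G : Graph) → Weight G → Set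
Proper G w = ∀ e → color G w (proj₁ (ends G e)) ≢ color G w (proj₂ (ends G e))

IsVertexCover : (G : Graph) → (Fin (n G) → Bool) → Set
IsVertexCover G S = ∀ e → T (S (proj₁ (ends G e))) ⊎ T (S (proj₂ (ends G e)))

size : ∀ {n} → (Fin n → Bool) → ℕ
size S = Σᶠ (λ v → if S v then 1 else 0)

VertexCoverNumber : Graph → ℕ → Set
VertexCoverNumber G k =
  (Σ (Fin (n G) → Bool) λ S → IsVertexCover G S × size S ≡ k)
  × (∀ S → IsVertexCover G S → k ≤ size S)

-- Fix a vertex cover S with |S| = k. A vertex outside S has all its neighbours in S, so its colour is
-- at most k. Among proper weightings we descend along the energy Σ_v color(v)², showing that a proper
-- weighting with a vertex c of colour X > 8k² + 8k can be modified into a proper one of smaller energy.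
-- Such a c lies in S and has at least X − k neighbours u ∉ S with w(cu) = 1. Call u free if no
-- neighbour x ≠ c of u has colour color(u) − 1.
--   * If more than k of them are free, set w(cu) = 0 for t ≤ k + 1 free u, choosing t so that X − t
--     is not the colour of a cover vertex: c drops by t, each such u by one, nothing else changes.
--   * Otherwise each non-free u has a blocker s ∈ S with color(s) = color(u) − 1 < k. Blockers through
--     edges of weight 1 account for at most k such u each, so as X > 8k² + 8k some s blocks at least
--     3k + 2 of them through edges of weight 0. Move the weight of t of the edges cu onto su, with
--     k < t ≤ 3k + 2 chosen so that neither X − t nor color(s) + t meets the colour of a cover vertex
--     or the other: c drops by t, s rises by t, and as color(s) < X − t the energy still decreases.

module Submission where

open import Defs
open import Level using (Level)
open import Data.Nat using (ℕ; zero; suc; _+_; _*_; _≤_; _<_; z≤n; s≤s; s≤s⁻¹)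
open import Data.Nat.Properties hiding (_≟_)
import Data.Nat as ℕ
open import Data.Fin using (Fin; zero; suc; toℕ)
open import Data.Fin.Properties using (_≟_; any?; all?; ¬∀⟶∃¬; toℕ-injective)
import Data.Fin.Properties as Finₚ
open import Data.Bool using (Bool; true; false; T; if_then_else_)
open import Data.Product using (_×_; _,_; proj₁; proj₂; Σ; ∃)
open import Data.Sum using (_⊎_; inj₁; inj₂; [_,_]′)
import Data.Sum
open import Data.Empty using (⊥; ⊥-elim)
open import Function using (_∘_; id; flip)
open import Relation.Nullary using (¬_; Dec; yes; no; does; contradiction)
open import Relation.Nullary.Decidable using (T?; _×-dec_; _⊎-dec_; ¬?; does-⇔; dec-true; dec-false; decidable-stable)
open import Relation.Binary.Definitions using (Symmetric)
open import Function.Bundles using (mk⇔)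
open import Relation.Unary using (Pred; Decidable; _⊆_; Empty)
open import Relation.Unary.Properties using (_∪?_)
open import Data.Vec.Functional using (_∷_)
open import Relation.Binary.PropositionalEquality
open import Data.Nat.Induction using (<-wellFounded)
open import Induction.WellFounded using (Acc; acc)
open import Data.Nat.Tactic.RingSolver using (solve-∀)
open import Algebra.Properties.Semiring.Sum +-*-semiring using (sum; sum-cong-≗; ∑-distrib-+; ∑-comm)

private variable
  n₁ n₂ : ℕ
  p q : Level

-- Finite sums and counting

Σᶠ≡sum : (f : Fin n₁ → ℕ) → Σᶠ f ≡ sum f
Σᶠ≡sum {zero} f = refl
Σᶠ≡sum {suc n₁} f = cong (f zero +_) (Σᶠ≡sum (f ∘ suc))

Σᶠ-cong : {f g : Fin n₁ → ℕ} → (∀ i → f i ≡ g i) → Σᶠ f ≡ Σᶠ g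
Σᶠ-cong {f = f} {g} f≗g = trans (Σᶠ≡sum f) (trans (sum-cong-≗ f≗g) (sym (Σᶠ≡sum g)))

Σᶠ-distrib-+ : (f g : Fin n₁ → ℕ) → Σᶠ (λ i → f i + g i) ≡ Σᶠ f + Σᶠ g
Σᶠ-distrib-+ f g = begin
  Σᶠ (λ i → f i + g i) ≡⟨ Σᶠ≡sum (λ i → f i + g i) ⟩
  sum (λ i → f i + g i) ≡⟨ ∑-distrib-+ f g ⟩
  sum f + sum g         ≡⟨ cong₂ _+_ (Σᶠ≡sum f) (Σᶠ≡sum g) ⟨
  Σᶠ f + Σᶠ g           ∎
  where open ≡-Reasoning

Σᶠ-comm : (f : Fin n₁ → Fin n₂ → ℕ) → Σᶠ (λ i → Σᶠ (f i)) ≡ Σᶠ (λ j → Σᶠ (λ i → f i j))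
Σᶠ-comm f = begin
  Σᶠ (λ i → Σᶠ (f i))            ≡⟨ Σᶠ²≡sum² f ⟩
  sum (λ i → sum (f i))          ≡⟨ ∑-comm f ⟩
  sum (λ j → sum (λ i → f i j))  ≡⟨ Σᶠ²≡sum² (λ j i → f i j) ⟨
  Σᶠ (λ j → Σᶠ (λ i → f i j))    ∎
  where
  open ≡-Reasoning
  Σᶠ²≡sum² : ∀ {a b} (g : Fin a → Fin b → ℕ) → Σᶠ (λ i → Σᶠ (g i)) ≡ sum (λ i → sum (g i))
  Σᶠ²≡sum² g = trans (Σᶠ-cong (Σᶠ≡sum ∘ g)) (Σᶠ≡sum (λ i → sum (g i)))

Σᶠ-mono-≤ : {f g : Fin n₁ → ℕ} → (∀ i → f i ≤ g i) → Σᶠ f ≤ Σᶠ g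
Σᶠ-mono-≤ {zero} f≤g = z≤n
Σᶠ-mono-≤ {suc n₁} f≤g = +-mono-≤ (f≤g zero) (Σᶠ-mono-≤ (f≤g ∘ suc))

Σᶠ-mono-< : {f g : Fin n₁ → ℕ} → (∀ i → f i ≤ g i) → ∀ j → f j < g j → Σᶠ f < Σᶠ g
Σᶠ-mono-< f≤g zero fj<gj = +-mono-<-≤ fj<gj (Σᶠ-mono-≤ (f≤g ∘ suc))
Σᶠ-mono-< f≤g (suc j) fj<gj = +-mono-≤-< (f≤g zero) (Σᶠ-mono-< (f≤g ∘ suc) j fj<gj)

f≤Σᶠ : (f : Fin n₁ → ℕ) → ∀ i → f i ≤ Σᶠ f
f≤Σᶠ f zero = m≤m+n (f zero) _
f≤Σᶠ f (suc i) = ≤-trans (f≤Σᶠ (f ∘ suc) i) (m≤n+m _ (f zero))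

indicator : ∀ {A : Set p} → Dec A → ℕ
indicator a? = if does a? then 1 else 0

indicator-yes : ∀ {A : Set p} (a? : Dec A) → A → indicator a? ≡ 1
indicator-yes (yes _) _ = refl
indicator-yes (no ¬a) a = contradiction a ¬a

indicator≤1 : ∀ {A : Set p} (a? : Dec A) → indicator a? ≤ 1
indicator≤1 (yes _) = ≤-refl
indicator≤1 (no _) = z≤n

indicator-no : ∀ {A : Set p} (a? : Dec A) → ¬ A → indicator a? ≡ 0
indicator-no (yes a) ¬a = contradiction a ¬a
indicator-no (no _) _ = refl

count : {P : Pred (Fin n₁) p} → Decidable P → ℕ
count P? = Σᶠ (indicator ∘ P?)

count-mono : {P : Pred (Fin n₁) p} {Q : Pred (Fin n₁) q} (P? : Decidable P) (Q? : Decidable Q) →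
             P ⊆ Q → count P? ≤ count Q?
count-mono P? Q? P⊆Q = Σᶠ-mono-≤ pointwise
  where
  pointwise : ∀ i → indicator (P? i) ≤ indicator (Q? i)
  pointwise i with P? i | Q? i
  ... | no _ | _ = z≤n
  ... | yes _ | yes _ = ≤-refl
  ... | yes pi | no ¬qi = contradiction (P⊆Q pi) ¬qi

count-cong : {P : Pred (Fin n₁) p} {Q : Pred (Fin n₁) q} (P? : Decidable P) (Q? : Decidable Q) →
             P ⊆ Q → Q ⊆ P → count P? ≡ count Q?
count-cong P? Q? P⊆Q Q⊆P = ≤-antisym (count-mono P? Q? P⊆Q) (count-mono Q? P? Q⊆P)

count-empty : {P : Pred (Fin n₁) p} (P? : Decidable P) → Empty P → count P? ≡ 0
count-empty {n₁ = zero} P? ∅ = refl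
count-empty {n₁ = suc _} P? ∅ with P? zero
... | yes p0 = contradiction p0 (∅ zero)
... | no _ = count-empty (P? ∘ suc) (∅ ∘ suc)

count-full : {P : Pred (Fin n₁) p} (P? : Decidable P) → (∀ i → P i) → count P? ≡ n₁
count-full {n₁ = zero} P? all = refl
count-full {n₁ = suc _} P? all with P? zero
... | yes _ = cong suc (count-full (P? ∘ suc) (all ∘ suc))
... | no ¬p0 = contradiction (all zero) ¬p0

count≤1 : {P : Pred (Fin n₁) p} (P? : Decidable P) → (∀ {i j} → P i → P j → i ≡ j) → count P? ≤ 1
count≤1 {n₁ = zero} P? unique = z≤n
count≤1 {n₁ = suc _} P? unique with P? zero
... | yes p0 = ≤-reflexive (cong suc (count-empty (P? ∘ suc) λ i pi → Finₚ.0≢1+n (unique p0 pi)))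
... | no _ = count≤1 (P? ∘ suc) λ pi pj → Finₚ.suc-injective (unique pi pj)

count-singleton : (j : Fin n₁) → count (_≟ j) ≡ 1
count-singleton j = ≤-antisym (count≤1 (_≟ j) λ i≡j k≡j → trans i≡j (sym k≡j))
                              (≤-trans (≤-reflexive (sym (indicator-yes (j ≟ j) refl))) (f≤Σᶠ _ j))

count-∪ : {P : Pred (Fin n₁) p} {Q : Pred (Fin n₁) q} (P? : Decidable P) (Q? : Decidable Q) →
          count (P? ∪? Q?) ≤ count P? + count Q?
count-∪ P? Q? = ≤-trans (Σᶠ-mono-≤ pointwise) (≤-reflexive (Σᶠ-distrib-+ (indicator ∘ P?) (indicator ∘ Q?)))
  where
  pointwise : ∀ i → indicator ((P? ∪? Q?) i) ≤ indicator (P? i) + indicator (Q? i)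
  pointwise i with P? i | Q? i
  ... | yes _ | _ = s≤s z≤n
  ... | no _ | yes _ = s≤s z≤n
  ... | no _ | no _ = z≤n

Σᶠ-indicator : {P : Pred (Fin n₁) p} (P? : Decidable P) (a : ℕ) →
               Σᶠ (λ i → if does (P? i) then a else 0) ≡ count P? * a
Σᶠ-indicator {n₁ = zero} P? a = refl
Σᶠ-indicator {n₁ = suc _} P? a with P? zero
... | yes _ = cong (a +_) (Σᶠ-indicator (P? ∘ suc) a)
... | no _ = Σᶠ-indicator (P? ∘ suc) a

count-satisfiable : {P : Pred (Fin n₁) p} (P? : Decidable P) → 0 < count P? → ∃ P
count-satisfiable {n₁ = suc _} P? 0<count with P? zero
... | yes p0 = zero , p0
... | no _ = let i , pi = count-satisfiable (P? ∘ suc) 0<count in suc i , pi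

count<⇒∃∁ : {P : Pred (Fin n₁) p} (P? : Decidable P) → count P? < n₁ → ∃ λ i → ¬ P i
count<⇒∃∁ {n₁ = n₁} {P = P} P? count<n =
  ¬∀⟶∃¬ n₁ P P? λ all → <-irrefl (count-full P? all) count<n

select : {P : Pred (Fin n₁) p} (P? : Decidable P) → ∀ j → j ≤ count P? →
         Σ (Fin n₁ → Bool) λ A → (∀ i → T (A i) → P i) × size A ≡ j
select {n₁ = n₁} P? zero _ = (λ _ → false) , (λ _ ()) , count-empty {n₁ = n₁} {P = λ _ → ⊥} (λ _ → no id) (λ _ ())
select {n₁ = zero} P? (suc j) ()
select {n₁ = suc _} P? (suc j) j<count with P? zero
... | yes p0 = let A , A⊆P , |A| = select (P? ∘ suc) j (s≤s⁻¹ j<count)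
               in true ∷ A , (λ { zero _ → p0 ; (suc i) → A⊆P i }) , cong suc |A|
... | no _ = let A , A⊆P , |A| = select (P? ∘ suc) (suc j) j<count
             in false ∷ A , (λ { zero () ; (suc i) → A⊆P i }) , |A|

unforbidden-offset : ∀ r b {F : Pred ℕ p} (F? : Decidable F) →
                     count (λ (j : Fin (suc r)) → F? (b + toℕ j)) ≤ r → ∃ λ t → b ≤ t × t ≤ b + r × ¬ F t
unforbidden-offset r b F? few =
  let j , ¬F = count<⇒∃∁ (λ j → F? (b + toℕ j)) (s≤s few)
  in b + toℕ j , m≤m+n b (toℕ j) , +-monoʳ-≤ b (s≤s⁻¹ (Finₚ.toℕ<n j)) , ¬F

offset-injective : ∀ b {i j : Fin n₁} → b + toℕ i ≡ b + toℕ j → i ≡ j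
offset-injective b = toℕ-injective ∘ +-cancelˡ-≡ b _ _

double-injective : ∀ {a b} → a + a ≡ b + b → a ≡ b
double-injective {a} {b} a+a≡b+b = *-cancelˡ-≡ a b 2 (begin
  2 * a        ≡⟨ cong (a +_) (+-identityʳ a) ⟩
  a + a        ≡⟨ a+a≡b+b ⟩
  b + b        ≡⟨ cong (b +_) (+-identityʳ b) ⟨
  2 * b        ∎)
  where open ≡-Reasoning

count-∃≤Σcount : {R : Fin n₁ → Pred (Fin n₂) p} (R? : ∀ x → Decidable (R x)) →
                 count (λ j → any? (λ x → R? x j)) ≤ Σᶠ (λ x → count (R? x))
count-∃≤Σcount R? = begin
  count (λ j → any? (λ x → R? x j))           ≤⟨ Σᶠ-mono-≤ pointwise ⟩
  Σᶠ (λ j → Σᶠ (λ x → indicator (R? x j)))   ≡⟨ Σᶠ-comm (λ j x → indicator (R? x j)) ⟩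
  Σᶠ (λ x → count (R? x))                     ∎
  where
  open ≤-Reasoning
  pointwise : ∀ j → indicator (any? (λ x → R? x j)) ≤ Σᶠ (λ x → indicator (R? x j))
  pointwise j with any? (λ x → R? x j)
  ... | no _ = z≤n
  ... | yes (x , r) = ≤-trans (≤-reflexive (sym (indicator-yes (R? x j) r))) (f≤Σᶠ _ x)

count-∃-unique≤size : (S : Fin n₁ → Bool) {R : Fin n₁ → Pred (Fin n₂) p} (R? : ∀ x → Decidable (R x)) →
                  (∀ x {i j} → R x i → R x j → i ≡ j) →
                  count (λ j → any? (λ x → T? (S x) ×-dec R? x j)) ≤ size S
count-∃-unique≤size S R? unique =
  ≤-trans (count-∃≤Σcount (λ x j → T? (S x) ×-dec R? x j)) (Σᶠ-mono-≤ at-most-one-each)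
  where
  at-most-one-each : ∀ x → count (λ j → T? (S x) ×-dec R? x j) ≤ (if S x then 1 else 0)
  at-most-one-each x with S x
  ... | true = count≤1 (λ j → T? true ×-dec R? x j) λ (_ , ri) (_ , rj) → unique x ri rj
  ... | false = ≤-reflexive (count-empty (λ j → T? false ×-dec R? x j) λ { _ (() , _) })

Σᶠ-≤-size : (S : Fin n₁ → Bool) {f : Fin n₁ → ℕ} {b : ℕ} →
            (∀ x → ¬ T (S x) → f x ≡ 0) → (∀ x → f x ≤ b) → Σᶠ f ≤ size S * b
Σᶠ-≤-size S {f} {b} outside≡0 f≤b =
  ≤-trans (Σᶠ-mono-≤ pointwise) (≤-reflexive (Σᶠ-indicator (T? ∘ S) b))
  where
  pointwise : ∀ x → f x ≤ (if S x then b else 0)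
  pointwise x with S x in Sx
  ... | true = f≤b x
  ... | false = ≤-reflexive (outside≡0 x λ x∈S → subst T Sx x∈S)

Star : Fin n₁ → (Fin n₁ → Bool) → Fin n₁ → Fin n₁ → Set
Star c A v u = (v ≡ c × T (A u)) ⊎ (u ≡ c × T (A v))

star? : (c : Fin n₁) (A : Fin n₁ → Bool) → ∀ v u → Dec (Star c A v u)
star? c A v u = (v ≟ c ×-dec T? (A u)) ⊎-dec (u ≟ c ×-dec T? (A v))

Star-sym : {c : Fin n₁} {A : Fin n₁ → Bool} → Symmetric (Star c A)
Star-sym = Data.Sum.swap

count-Star-centre : (c : Fin n₁) (A : Fin n₁ → Bool) → ¬ T (A c) → count (star? c A c) ≡ size A
count-Star-centre c A c∉A = count-cong (star? c A c) (T? ∘ A) to from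
  where
  to : ∀ {u} → Star c A c u → T (A u)
  to (inj₁ (_ , u∈A)) = u∈A
  to (inj₂ (_ , c∈A)) = contradiction c∈A c∉A
  from : ∀ {u} → T (A u) → Star c A c u
  from u∈A = inj₁ (refl , u∈A)

count-Star-off-centre : (c : Fin n₁) (A : Fin n₁ → Bool) {v : Fin n₁} → v ≢ c →
                        count (star? c A v) ≡ (if A v then 1 else 0)
count-Star-off-centre c A {v} v≢c = by-membership (T? (A v))
  where
  by-membership : (v∈A? : Dec (T (A v))) → count (star? c A v) ≡ indicator v∈A?
  by-membership (yes v∈A) = trans (count-cong (star? c A v) (_≟ c) to from) (count-singleton c)
    where
    to : ∀ {u} → Star c A v u → u ≡ c
    to (inj₁ (v≡c , _)) = contradiction v≡c v≢c
    to (inj₂ (u≡c , _)) = u≡c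
    from : ∀ {u} → u ≡ c → Star c A v u
    from u≡c = inj₂ (u≡c , v∈A)
  by-membership (no v∉A) = count-empty (star? c A v) λ where
    _ (inj₁ (v≡c , _)) → v≢c v≡c
    _ (inj₂ (_ , v∈A)) → v∉A v∈A

Σᶠ-<-two-point : {f g : Fin n₁ → ℕ} {a b : Fin n₁} → a ≢ b →
                 (∀ i → i ≢ a → i ≢ b → f i ≤ g i) → f a + f b < g a + g b → Σᶠ f < Σᶠ g
Σᶠ-<-two-point {n₁ = n₁} {f = f} {g} {a} {b} a≢b f≤g fab<gab =
  +-cancelʳ-< (g a + g b) (Σᶠ f) (Σᶠ g) (≤-<-trans exchange (+-monoʳ-< (Σᶠ g) fab<gab))
  where
  open ≤-Reasoning
  at : Fin n₁ → Fin n₁ → ℕ → ℕ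
  at j i x = if does (i ≟ j) then x else 0
  Σ-at : (h : Fin n₁ → ℕ) → Σᶠ (λ i → at a i (h a) + at b i (h b)) ≡ h a + h b
  Σ-at h = begin-equality
    Σᶠ (λ i → at a i (h a) + at b i (h b))
      ≡⟨ Σᶠ-distrib-+ (λ i → at a i (h a)) (λ i → at b i (h b)) ⟩
    Σᶠ (λ i → at a i (h a)) + Σᶠ (λ i → at b i (h b))
      ≡⟨ cong₂ _+_ (Σᶠ-indicator (_≟ a) (h a)) (Σᶠ-indicator (_≟ b) (h b)) ⟩
    count (_≟ a) * h a + count (_≟ b) * h b
      ≡⟨ cong₂ (λ x y → x * h a + y * h b) (count-singleton a) (count-singleton b) ⟩
    1 * h a + 1 * h b
      ≡⟨ cong₂ _+_ (*-identityˡ (h a)) (*-identityˡ (h b)) ⟩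
    h a + h b
      ∎
  pointwise : ∀ i → f i + (at a i (g a) + at b i (g b)) ≤ g i + (at a i (f a) + at b i (f b))
  pointwise i with i ≟ a | i ≟ b
  ... | yes refl | yes i≡b = contradiction i≡b a≢b
  ... | yes refl | no _ = ≤-reflexive (+0-comm (f i) (g i))
    where
    +0-comm : ∀ x y → x + (y + 0) ≡ y + (x + 0)
    +0-comm x y rewrite +-identityʳ x | +-identityʳ y = +-comm x y
  ... | no _ | yes refl = ≤-reflexive (+-comm (f i) (g i))
  ... | no i≢a | no i≢b = +-monoˡ-≤ 0 (f≤g i i≢a i≢b)
  exchange : Σᶠ f + (g a + g b) ≤ Σᶠ g + (f a + f b)
  exchange = begin
    Σᶠ f + (g a + g b)                                          ≡⟨ cong (Σᶠ f +_) (Σ-at g) ⟨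
    Σᶠ f + Σᶠ (λ i → at a i (g a) + at b i (g b))              ≡⟨ Σᶠ-distrib-+ f _ ⟨
    Σᶠ (λ i → f i + (at a i (g a) + at b i (g b)))             ≤⟨ Σᶠ-mono-≤ pointwise ⟩
    Σᶠ (λ i → g i + (at a i (f a) + at b i (f b)))             ≡⟨ Σᶠ-distrib-+ g _ ⟩
    Σᶠ g + Σᶠ (λ i → at a i (f a) + at b i (f b))              ≡⟨ cong (Σᶠ g +_) (Σ-at f) ⟩
    Σᶠ g + (f a + f b)                                          ∎

square-mono-≤ : ∀ {a b} → a ≤ b → a * a ≤ b * b
square-mono-≤ a≤b = *-mono-≤ a≤b a≤b

square-mono-< : ∀ {a b} → a < b → a * a < b * b
square-mono-< a<b = *-mono-< a<b a<b

square-transfer-< : ∀ y t a → a < y → 0 < t → y * y + (a + t) * (a + t) < (y + t) * (y + t) + a * a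
square-transfer-< y t@(suc _) a a<y _ = subst₂ _<_ (sym (expand-left y t a)) (sym (expand-right y t a))
  (+-monoʳ-< (y * y + t * t + a * a) (*-monoʳ-< 2 (*-monoˡ-< t a<y)))
  where
  expand-left : ∀ y t a → y * y + (a + t) * (a + t) ≡ y * y + t * t + a * a + 2 * (a * t)
  expand-left = solve-∀
  expand-right : ∀ y t a → (y + t) * (y + t) + a * a ≡ y * y + t * t + a * a + 2 * (y * t)
  expand-right = solve-∀

bound : ℕ → ℕ
bound k = 8 * k * k + 8 * k

k≤bound : ∀ k → k ≤ bound k
k≤bound k = ≤-trans (m≤m+n k (7 * k)) (m≤n+m (8 * k) (8 * k * k))

offset-room : ∀ {k t} → 0 < k → t ≤ suc k + suc (k + k) → k + t ≤ bound k
offset-room {k} {t} k>0 t≤ = ≤-trans (+-monoʳ-≤ k t≤) (linear≤bound k>0)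
  where
  expand : ∀ k′ → suc k′ + (suc (suc k′) + suc (suc k′ + suc k′)) + (8 * k′ * k′ + 20 * k′ + 10)
                ≡ 8 * suc k′ * suc k′ + 8 * suc k′
  expand = solve-∀
  linear≤bound : ∀ {k} → 0 < k → k + (suc k + suc (k + k)) ≤ bound k
  linear≤bound {suc k′} _ = ≤-trans (m≤m+n _ (8 * k′ * k′ + 20 * k′ + 10)) (≤-reflexive (expand k′))

counting-room : ∀ k → k + (k + k * (k + suc (k + k) + k)) ≤ bound k
counting-room k = ≤-trans (m≤m+n _ (4 * k * k + 5 * k)) (≤-reflexive (expand k))
  where
  expand : ∀ k → k + (k + k * (k + suc (k + k) + k)) + (4 * k * k + 5 * k) ≡ 8 * k * k + 8 * k
  expand = solve-∀

descent : {A : Set p} (Φ : A → ℕ) {P Q : A → Set q} →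
          (∀ x → P x → Q x ⊎ ∃ λ y → P y × Φ y < Φ x) → ∀ x → P x → ∃ λ y → P y × Q y
descent Φ {P} {Q} step x px = go x px (<-wellFounded (Φ x))
  where
  go : ∀ x → P x → Acc _<_ (Φ x) → ∃ λ y → P y × Q y
  go x px (acc smaller) with step x px
  ... | inj₁ qx = x , px , qx
  ... | inj₂ (y , py , Φy<Φx) = go y py (smaller Φy<Φx)

-- Edges between pairs of vertices

module _ (G : Graph) where

  private
    V E : Set
    V = Fin (n G)
    E = Fin (m G)

  end₁ end₂ : E → V
  end₁ e = proj₁ (ends G e)
  end₂ e = proj₂ (ends G e)

  Joins : E → V → V → Set
  Joins e v u = (end₁ e ≡ v × end₂ e ≡ u) ⊎ (end₁ e ≡ u × end₂ e ≡ v)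

  joins? : ∀ e v u → Dec (Joins e v u)
  joins? e v u = (end₁ e ≟ v ×-dec end₂ e ≟ u) ⊎-dec (end₁ e ≟ u ×-dec end₂ e ≟ v)

  Joins-sym : ∀ {e v u} → Joins e v u → Joins e u v
  Joins-sym = Data.Sum.swap

  Joins-irrefl : ∀ {e v} → ¬ Joins e v v
  Joins-irrefl {e} (inj₁ (e₁≡v , e₂≡v)) = loopless G e (trans e₁≡v (sym e₂≡v))
  Joins-irrefl {e} (inj₂ (e₁≡v , e₂≡v)) = loopless G e (trans e₁≡v (sym e₂≡v))

  Joins-unique : ∀ {e f v u} → Joins e v u → Joins f v u → e ≡ f
  Joins-unique {e} {f} (inj₁ (refl , refl)) (inj₁ (e₁ , e₂)) = simple G e f (inj₁ (sym e₁ , sym e₂))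
  Joins-unique {e} {f} (inj₁ (refl , refl)) (inj₂ (e₁ , e₂)) = simple G e f (inj₂ (sym e₂ , sym e₁))
  Joins-unique {e} {f} (inj₂ (refl , refl)) (inj₁ (e₁ , e₂)) = simple G e f (inj₂ (sym e₂ , sym e₁))
  Joins-unique {e} {f} (inj₂ (refl , refl)) (inj₂ (e₁ , e₂)) = simple G e f (inj₁ (sym e₁ , sym e₂))

  private
    inc-end₁ : ∀ {e v} → end₁ e ≡ v → inc G e v ≡ 1
    inc-end₁ {e} {v} e₁≡v with proj₁ (ends G e) ≟ v | proj₂ (ends G e) ≟ v
    ... | yes _ | _ = refl
    ... | no e₁≢v | _ = contradiction e₁≡v e₁≢v

    inc-end₂ : ∀ {e v} → end₂ e ≡ v → inc G e v ≡ 1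
    inc-end₂ {e} {v} e₂≡v with proj₁ (ends G e) ≟ v | proj₂ (ends G e) ≟ v
    ... | yes _ | _ = refl
    ... | no _ | yes _ = refl
    ... | no _ | no e₂≢v = contradiction e₂≡v e₂≢v

    inc-other : ∀ {e v} → end₁ e ≢ v → end₂ e ≢ v → inc G e v ≡ 0
    inc-other {e} {v} e₁≢v e₂≢v with proj₁ (ends G e) ≟ v | proj₂ (ends G e) ≟ v
    ... | yes e₁≡v | _ = contradiction e₁≡v e₁≢v
    ... | no _ | yes e₂≡v = contradiction e₂≡v e₂≢v
    ... | no _ | no _ = refl

  count-joins≡inc : ∀ e v → count (joins? e v) ≡ inc G e v
  count-joins≡inc e v = by-ends (end₁ e ≟ v) (end₂ e ≟ v)
    where
    -- Splitting with `with` instead would also rewrite these decisions inside `joins? e v`.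
    open ≡-Reasoning
    by-ends : Dec (end₁ e ≡ v) → Dec (end₂ e ≡ v) → count (joins? e v) ≡ inc G e v
    by-ends (yes e₁≡v) (yes e₂≡v) = contradiction (trans e₁≡v (sym e₂≡v)) (loopless G e)
    by-ends (yes e₁≡v) (no e₂≢v) = begin
      count (joins? e v)    ≡⟨ count-cong (joins? e v) (_≟ end₂ e) to from ⟩
      count (_≟ end₂ e)     ≡⟨ count-singleton (end₂ e) ⟩
      1                     ≡⟨ inc-end₁ e₁≡v ⟨
      inc G e v             ∎
      where
      to : ∀ {u} → Joins e v u → u ≡ end₂ e
      to (inj₁ (_ , e₂≡u)) = sym e₂≡u
      to (inj₂ (_ , e₂≡v)) = contradiction e₂≡v e₂≢v
      from : ∀ {u} → u ≡ end₂ e → Joins e v u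
      from refl = inj₁ (e₁≡v , refl)
    by-ends (no e₁≢v) (yes e₂≡v) = begin
      count (joins? e v)    ≡⟨ count-cong (joins? e v) (_≟ end₁ e) to from ⟩
      count (_≟ end₁ e)     ≡⟨ count-singleton (end₁ e) ⟩
      1                     ≡⟨ inc-end₂ e₂≡v ⟨
      inc G e v             ∎
      where
      to : ∀ {u} → Joins e v u → u ≡ end₁ e
      to (inj₁ (e₁≡v , _)) = contradiction e₁≡v e₁≢v
      to (inj₂ (e₁≡u , _)) = sym e₁≡u
      from : ∀ {u} → u ≡ end₁ e → Joins e v u
      from refl = inj₂ (refl , e₂≡v)
    by-ends (no e₁≢v) (no e₂≢v) = begin
      count (joins? e v)    ≡⟨ count-empty (joins? e v) not-joined ⟩
      0                     ≡⟨ inc-other e₁≢v e₂≢v ⟨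
      inc G e v             ∎
      where
      not-joined : Empty (Joins e v)
      not-joined _ (inj₁ (e₁≡v , _)) = e₁≢v e₁≡v
      not-joined _ (inj₂ (_ , e₂≡v)) = e₂≢v e₂≡v

  Adjacent : V → V → Set
  Adjacent v u = ∃ λ e → Joins e v u

  adjacent? : ∀ v u → Dec (Adjacent v u)
  adjacent? v u = any? λ e → joins? e v u

  Adjacent-sym : ∀ {v u} → Adjacent v u → Adjacent u v
  Adjacent-sym (e , joins) = e , Joins-sym joins

  Adjacent-irrefl : ∀ {v u} → Adjacent v u → v ≢ u
  Adjacent-irrefl (e , joins) refl = Joins-irrefl joins

  adjacent-covered : ∀ {S v u} → IsVertexCover G S → Adjacent v u → T (S v) ⊎ T (S u)
  adjacent-covered cover (e , inj₁ (refl , refl)) = cover e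
  adjacent-covered cover (e , inj₂ (refl , refl)) = Data.Sum.swap (cover e)

  multiplicity : V → V → ℕ
  multiplicity v u = count λ e → joins? e v u

  multiplicity≤1 : ∀ v u → multiplicity v u ≤ 1
  multiplicity≤1 v u = count≤1 (λ e → joins? e v u) Joins-unique

  Adjacent⇒multiplicity≡1 : ∀ {v u} → Adjacent v u → multiplicity v u ≡ 1
  Adjacent⇒multiplicity≡1 {v} {u} (e , joins) =
    ≤-antisym (multiplicity≤1 v u) (≤-trans (≤-reflexive (sym (indicator-yes (joins? e v u) joins))) (f≤Σᶠ _ e))

  pairWeight : Weight G → V → V → ℕ
  pairWeight w v u = Σᶠ λ e → if does (joins? e v u) then toℕ₂ (w e) else 0

  pairWeight≤multiplicity : ∀ w v u → pairWeight w v u ≤ multiplicity v u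
  pairWeight≤multiplicity w v u = Σᶠ-mono-≤ weight≤indicator
    where
    weight≤indicator : ∀ e → (if does (joins? e v u) then toℕ₂ (w e) else 0) ≤ indicator (joins? e v u)
    weight≤indicator e with does (joins? e v u)
    ... | true = Finₚ.toℕ≤pred[n] (w e)
    ... | false = z≤n

  pairWeight≤1 : ∀ w v u → pairWeight w v u ≤ 1
  pairWeight≤1 w v u = ≤-trans (pairWeight≤multiplicity w v u) (multiplicity≤1 v u)

  pairWeight-sym : ∀ w v u → pairWeight w v u ≡ pairWeight w u v
  pairWeight-sym w v u = Σᶠ-cong λ e → cong (λ b → if b then toℕ₂ (w e) else 0)
    (does-⇔ (mk⇔ Joins-sym Joins-sym) (joins? e v u) (joins? e u v))

  pairWeight-positive⇒Adjacent : ∀ {w v u} → 0 < pairWeight w v u → Adjacent v u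
  pairWeight-positive⇒Adjacent {w} {v} {u} positive =
    count-satisfiable (λ e → joins? e v u) (<-≤-trans positive (pairWeight≤multiplicity w v u))

  color≡Σᶠ-pairWeight : ∀ w v → color G w v ≡ Σᶠ (pairWeight w v)
  color≡Σᶠ-pairWeight w v = begin
    Σᶠ (λ e → inc G e v * toℕ₂ (w e))
      ≡⟨ Σᶠ-cong (λ e → cong (_* toℕ₂ (w e)) (count-joins≡inc e v)) ⟨
    Σᶠ (λ e → count (joins? e v) * toℕ₂ (w e))
      ≡⟨ Σᶠ-cong (λ e → Σᶠ-indicator (joins? e v) (toℕ₂ (w e))) ⟨
    Σᶠ (λ e → Σᶠ (λ u → if does (joins? e v u) then toℕ₂ (w e) else 0))
      ≡⟨ Σᶠ-comm (λ e u → if does (joins? e v u) then toℕ₂ (w e) else 0) ⟩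
    Σᶠ (pairWeight w v)
      ∎
    where open ≡-Reasoning

  color-outside-cover : ∀ {S} → IsVertexCover G S → ∀ w {v} → ¬ T (S v) → color G w v ≤ size S
  color-outside-cover {S} cover w {v} v∉S = begin
    color G w v          ≡⟨ color≡Σᶠ-pairWeight w v ⟩
    Σᶠ (pairWeight w v)  ≤⟨ Σᶠ-≤-size S outside-S (pairWeight≤1 w v) ⟩
    size S * 1           ≡⟨ *-identityʳ (size S) ⟩
    size S               ∎
    where
    open ≤-Reasoning
    outside-S : ∀ u → ¬ T (S u) → pairWeight w v u ≡ 0
    outside-S u u∉S = n≤0⇒n≡0 (≮⇒≥ λ positive →
      [ v∉S , u∉S ]′ (adjacent-covered cover (pairWeight-positive⇒Adjacent {w} positive)))

  Proper⇒Adjacent-distinct : ∀ {w v u} → Proper G w → Adjacent v u → color G w v ≢ color G w u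
  Proper⇒Adjacent-distinct proper (e , inj₁ (refl , refl)) = proper e
  Proper⇒Adjacent-distinct proper (e , inj₂ (refl , refl)) = proper e ∘ sym

  Proper-from-covered-side : ∀ {S w} → IsVertexCover G S →
    (∀ a b → T (S a) → Adjacent a b → color G w a ≢ color G w b) → Proper G w
  Proper-from-covered-side cover distinct e with cover e
  ... | inj₁ e₁∈S = distinct _ _ e₁∈S (e , inj₁ (refl , refl))
  ... | inj₂ e₂∈S = distinct _ _ e₂∈S (e , inj₂ (refl , refl)) ∘ sym

  proper-after-lifting : ∀ {S} → IsVertexCover G S → ∀ {w w′} → Proper G w →
    {D : Pred V p} → Decidable D →
    (∀ {v} → T (S v) → ¬ D v → color G w′ v ≡ color G w v) →
    (∀ {d} → D d → size S < color G w′ d) →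
    (∀ {d x} → D d → T (S x) → x ≢ d → color G w′ d ≢ color G w′ x) →
    (∀ {x u} → T (S x) → ¬ D x → ¬ T (S u) → Adjacent x u → color G w′ u ≢ color G w x) →
    Proper G w′
  proper-after-lifting {S = S} cover {w} {w′} proper D? fixed lifted lifted-apart neighbours-apart =
    Proper-from-covered-side cover distinct
    where
    distinct : ∀ a b → T (S a) → Adjacent a b → color G w′ a ≢ color G w′ b
    distinct a b a∈S ab with D? a | D? b | T? (S b)
    ... | yes da | _ | yes b∈S = lifted-apart da b∈S (Adjacent-irrefl ab ∘ sym)
    ... | yes da | _ | no b∉S = λ same →
      <⇒≱ (lifted da) (subst (_≤ size S) (sym same) (color-outside-cover cover w′ b∉S))
    ... | no ¬da | yes db | _ = lifted-apart db a∈S (Adjacent-irrefl ab) ∘ sym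
    ... | no ¬da | no ¬db | yes b∈S = λ same →
      Proper⇒Adjacent-distinct proper ab (trans (sym (fixed a∈S ¬da)) (trans same (fixed b∈S ¬db)))
    ... | no ¬da | no _ | no b∉S = λ same → neighbours-apart a∈S ¬da b∉S ab (trans (sym same) (fixed a∈S ¬da))

  energy : Weight G → ℕ
  energy w = Σᶠ λ v → color G w v * color G w v

  -- Reweighting

  reweight : Weight G → {F : V → V → Set} → (∀ v u → Dec (F v u)) → Fin 2 → Weight G
  reweight w F? b e = if does (F? (end₁ e) (end₂ e)) then b else w e

  module _ (w : Weight G) {F : V → V → Set} (F? : ∀ v u → Dec (F v u)) (F-sym : Symmetric F) (b : Fin 2) where

    private
      at-ends : ∀ {e v u} → Joins e v u → F v u → F (end₁ e) (end₂ e)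
      at-ends (inj₁ (refl , refl)) = id
      at-ends (inj₂ (refl , refl)) = F-sym

      from-ends : ∀ {e v u} → Joins e v u → F (end₁ e) (end₂ e) → F v u
      from-ends (inj₁ (refl , refl)) = id
      from-ends (inj₂ (refl , refl)) = F-sym

    pairWeight-reweight-inside : ∀ {v u} → F v u → pairWeight (reweight w F? b) v u ≡ multiplicity v u * toℕ₂ b
    pairWeight-reweight-inside {v} {u} vu =
      trans (Σᶠ-cong λ e → reweighted e (joins? e v u)) (Σᶠ-indicator (λ e → joins? e v u) (toℕ₂ b))
      where
      reweighted : ∀ e (j? : Dec (Joins e v u)) →
        (if does j? then toℕ₂ (reweight w F? b e) else 0) ≡ (if does j? then toℕ₂ b else 0)
      reweighted e (yes j) rewrite dec-true (F? (end₁ e) (end₂ e)) (at-ends j vu) = refl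
      reweighted e (no _) = refl

    pairWeight-reweight-outside : ∀ {v u} → ¬ F v u → pairWeight (reweight w F? b) v u ≡ pairWeight w v u
    pairWeight-reweight-outside {v} {u} ¬vu = Σᶠ-cong λ e → reweighted e (joins? e v u)
      where
      reweighted : ∀ e (j? : Dec (Joins e v u)) →
        (if does j? then toℕ₂ (reweight w F? b e) else 0) ≡ (if does j? then toℕ₂ (w e) else 0)
      reweighted e (yes j) rewrite dec-false (F? (end₁ e) (end₂ e)) (¬vu ∘ from-ends j) = refl
      reweighted e (no _) = refl

  module _ (w : Weight G) {F₀ F₁ : V → V → Set}
           (F₀? : ∀ v u → Dec (F₀ v u)) (F₀-sym : Symmetric F₀)
           (F₁? : ∀ v u → Dec (F₁ v u)) (F₁-sym : Symmetric F₁) where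

    shift : Weight G
    shift = reweight (reweight w F₀? (suc zero)) F₁? zero

    color-shift : (∀ {v u} → F₀ v u → Adjacent v u × pairWeight w v u ≡ 0) →
                  (∀ {v u} → F₁ v u → pairWeight w v u ≡ 1) →
                  (∀ {v u} → F₀ v u → ¬ F₁ v u) →
                  ∀ v → color G shift v + count (F₁? v) ≡ color G w v + count (F₀? v)
    color-shift raised lowered disjoint v = begin
      color G shift v + count (F₁? v)
        ≡⟨ cong (_+ count (F₁? v)) (color≡Σᶠ-pairWeight shift v) ⟩
      Σᶠ (pairWeight shift v) + count (F₁? v)
        ≡⟨ Σᶠ-distrib-+ (pairWeight shift v) (indicator ∘ F₁? v) ⟨
      Σᶠ (λ u → pairWeight shift v u + indicator (F₁? v u))
        ≡⟨ Σᶠ-cong pairwise ⟩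
      Σᶠ (λ u → pairWeight w v u + indicator (F₀? v u))
        ≡⟨ Σᶠ-distrib-+ (pairWeight w v) (indicator ∘ F₀? v) ⟩
      Σᶠ (pairWeight w v) + count (F₀? v)
        ≡⟨ cong (_+ count (F₀? v)) (color≡Σᶠ-pairWeight w v) ⟨
      color G w v + count (F₀? v)
        ∎
      where
      open ≡-Reasoning
      raised-once : Weight G
      raised-once = reweight w F₀? (suc zero)
      pairwise : ∀ u → pairWeight shift v u + indicator (F₁? v u) ≡ pairWeight w v u + indicator (F₀? v u)
      pairwise u with F₁? v u | F₀? v u
      ... | yes f₁ | yes f₀ = contradiction f₁ (disjoint f₀)
      ... | yes f₁ | no _ = begin
        pairWeight shift v u + 1    ≡⟨ cong (_+ 1) (pairWeight-reweight-inside raised-once F₁? F₁-sym zero f₁) ⟩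
        multiplicity v u * 0 + 1    ≡⟨ cong (_+ 1) (*-zeroʳ (multiplicity v u)) ⟩
        1                           ≡⟨ lowered f₁ ⟨
        pairWeight w v u            ≡⟨ +-identityʳ (pairWeight w v u) ⟨
        pairWeight w v u + 0        ∎
      ... | no ¬f₁ | yes f₀ = begin
        pairWeight shift v u + 0        ≡⟨ +-identityʳ (pairWeight shift v u) ⟩
        pairWeight shift v u            ≡⟨ pairWeight-reweight-outside raised-once F₁? F₁-sym zero ¬f₁ ⟩
        pairWeight raised-once v u      ≡⟨ pairWeight-reweight-inside w F₀? F₀-sym (suc zero) f₀ ⟩
        multiplicity v u * 1            ≡⟨ *-identityʳ (multiplicity v u) ⟩
        multiplicity v u                ≡⟨ Adjacent⇒multiplicity≡1 (proj₁ (raised f₀)) ⟩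
        1                               ≡⟨ cong (_+ 1) (proj₂ (raised f₀)) ⟨
        pairWeight w v u + 1            ∎
      ... | no ¬f₁ | no ¬f₀ = cong (_+ 0) (trans (pairWeight-reweight-outside raised-once F₁? F₁-sym zero ¬f₁)
                                                 (pairWeight-reweight-outside w F₀? F₀-sym (suc zero) ¬f₀))

  color-lower : (w : Weight G) {F : V → V → Set} (F? : ∀ v u → Dec (F v u)) → Symmetric F →
                (∀ {v u} → F v u → pairWeight w v u ≡ 1) →
                ∀ v → color G (reweight w F? zero) v + count (F? v) ≡ color G w v
  -- Raising along the empty relation is definitionally the identity, so `shift` specialises to `reweight`.
  color-lower w F? F-sym lowered v = begin
    color G (reweight w F? zero) v + count (F? v)  ≡⟨ color-shift w nowhere? (λ ()) F? F-sym (λ ()) lowered (λ ()) v ⟩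
    color G w v + count (nowhere? v)                ≡⟨ cong (color G w v +_) (count-empty (nowhere? v) λ _ ()) ⟩
    color G w v + 0                                 ≡⟨ +-identityʳ (color G w v) ⟩
    color G w v                                     ∎
    where
    open ≡-Reasoning
    nowhere? : ∀ (x y : V) → Dec ⊥
    nowhere? _ _ = no id

-- Decreasing the energy

module Improvement (G : Graph) {S : Fin (n G) → Bool} (cover : IsVertexCover G S)
                   (w : Weight G) (proper : Proper G w) (c : Fin (n G))
                   (c-large : bound (size S) < color G w c) where

  private
    V : Set
    V = Fin (n G)
    k : ℕ
    k = size S
    col : V → ℕ
    col = color G w

  LowerEnergy : Set
  LowerEnergy = Σ (Weight G) λ w′ → Proper G w′ × energy G w′ < energy G w

  c∈S : T (S c)
  c∈S = decidable-stable (T? (S c)) λ c∉S →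
    <⇒≱ c-large (≤-trans (color-outside-cover G cover w c∉S) (k≤bound k))

  k>0 : 0 < k
  k>0 = ≤-trans (≤-reflexive (sym (indicator-yes (T? (S c)) c∈S))) (f≤Σᶠ (indicator ∘ T? ∘ S) c)

  outside≢c : ∀ {u} → ¬ T (S u) → u ≢ c
  outside≢c u∉S refl = u∉S c∈S

  neighbour-in-cover : ∀ {s u} → ¬ T (S u) → Adjacent G s u → T (S s)
  neighbour-in-cover u∉S su = [ id , flip contradiction u∉S ]′ (adjacent-covered G cover su)

  Droppable : V → Set
  Droppable u = ¬ T (S u) × pairWeight G w c u ≡ 1

  Blocks : V → V → Set
  Blocks x u = Adjacent G u x × x ≢ c × col x + 1 ≡ col u

  Free : V → Set
  Free u = Droppable u × (∀ x → ¬ Blocks x u)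

  module Lowering (A : V → Bool) (A-free : ∀ {u} → T (A u) → Free u)
                  (t : ℕ) (|A|≡t : size A ≡ t) (t>0 : 0 < t) (room : k + t < col c)
                  (avoids : ∀ {x} → T (S x) → col x + t ≢ col c) where

    lowered : Weight G
    lowered = reweight G w (star? c A) zero

    private
      col′ : V → ℕ
      col′ = color G lowered

      cover∉A : ∀ {v} → T (S v) → ¬ T (A v)
      cover∉A v∈S v∈A = proj₁ (proj₁ (A-free v∈A)) v∈S

    lowered-colors : ∀ v → col′ v + count (star? c A v) ≡ col v
    lowered-colors = color-lower G w (star? c A) Star-sym λ where
      (inj₁ (refl , u∈A)) → proj₂ (proj₁ (A-free u∈A))
      (inj₂ (refl , v∈A)) → trans (pairWeight-sym G w _ c) (proj₂ (proj₁ (A-free v∈A)))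

    centre : col′ c + t ≡ col c
    centre = trans (cong (col′ c +_) (sym (trans (count-Star-centre c A (cover∉A c∈S)) |A|≡t))) (lowered-colors c)

    off-centre : ∀ {v} → v ≢ c → col′ v + (if A v then 1 else 0) ≡ col v
    off-centre {v} v≢c = trans (cong (col′ v +_) (sym (count-Star-off-centre c A v≢c))) (lowered-colors v)

    dropped : ∀ {v} → T (A v) → v ≢ c → col′ v + 1 ≡ col v
    dropped {v} v∈A v≢c = trans (cong (col′ v +_) (sym (indicator-yes (T? (A v)) v∈A))) (off-centre v≢c)

    unchanged : ∀ {v} → ¬ T (A v) → v ≢ c → col′ v ≡ col v
    unchanged {v} v∉A v≢c =
      trans (sym (+-identityʳ (col′ v))) (trans (cong (col′ v +_) (sym (indicator-no (T? (A v)) v∉A))) (off-centre v≢c))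

    lowered-proper : Proper G lowered
    lowered-proper = proper-after-lifting G cover proper (_≟ c)
      (λ v∈S v≢c → unchanged (cover∉A v∈S) v≢c) lifted lifted-apart neighbours-apart
      where
      lifted : ∀ {d} → d ≡ c → k < col′ d
      lifted refl = +-cancelʳ-< t k (col′ c) (subst (k + t <_) (sym centre) room)
      lifted-apart : ∀ {d x} → d ≡ c → T (S x) → x ≢ d → col′ d ≢ col′ x
      lifted-apart refl x∈S x≢c same =
        avoids x∈S (trans (cong (_+ t) (trans (sym (unchanged (cover∉A x∈S) x≢c)) (sym same))) centre)
      neighbours-apart : ∀ {x u} → T (S x) → x ≢ c → ¬ T (S u) → Adjacent G x u → col′ u ≢ col x
      neighbours-apart {x} {u} x∈S x≢c u∉S xu same with T? (A u)
      ... | yes u∈A = proj₂ (A-free u∈A) x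
        (Adjacent-sym G xu , x≢c , trans (cong (_+ 1) (sym same)) (dropped u∈A (outside≢c u∉S)))
      ... | no u∉A = Proper⇒Adjacent-distinct G proper xu (sym (trans (sym (unchanged u∉A (outside≢c u∉S))) same))

    lowered-energy : energy G lowered < energy G w
    lowered-energy = Σᶠ-mono-< (λ v → square-mono-≤ (decreases v)) c (square-mono-< centre-decreases)
      where
      decreases : ∀ v → col′ v ≤ col v
      decreases v = subst (col′ v ≤_) (lowered-colors v) (m≤m+n (col′ v) _)
      centre-decreases : col′ c < col c
      centre-decreases = subst (col′ c <_) centre (m<m+n (col′ c) t>0)

  Transferable : V → V → Set
  Transferable s u = Droppable u × Adjacent G s u × pairWeight G w s u ≡ 0

  module Transfer (s : V) (s∈S : T (S s)) (s-small : col s < k)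
                  (A : V → Bool) (A-transferable : ∀ {u} → T (A u) → Transferable s u)
                  (t : ℕ) (|A|≡t : size A ≡ t) (k<t : k < t) (room : k + t < col c)
                  (s-avoids : ∀ {x} → T (S x) → col x ≢ col s + t)
                  (c-avoids : ∀ {x} → T (S x) → col x + t ≢ col c)
                  (apart : col s + t + t ≢ col c) where

    transferred : Weight G
    transferred = shift G w (star? s A) Star-sym (star? c A) Star-sym

    private
      col′ : V → ℕ
      col′ = color G transferred

      cover∉A : ∀ {v} → T (S v) → ¬ T (A v)
      cover∉A v∈S v∈A = proj₁ (proj₁ (A-transferable v∈A)) v∈S

      s≢c : s ≢ c
      s≢c refl = <-asym s-small (≤-<-trans (k≤bound k) c-large)

    transferred-colors : ∀ v → col′ v + count (star? c A v) ≡ col v + count (star? s A v)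
    transferred-colors = color-shift G w (star? s A) Star-sym (star? c A) Star-sym raised lowered disjoint
      where
      raised : ∀ {v u} → Star s A v u → Adjacent G v u × pairWeight G w v u ≡ 0
      raised (inj₁ (refl , u∈A)) = let _ , su , weight≡0 = A-transferable u∈A in su , weight≡0
      raised (inj₂ (refl , v∈A)) = let _ , sv , weight≡0 = A-transferable v∈A in
        Adjacent-sym G sv , trans (pairWeight-sym G w _ s) weight≡0
      lowered : ∀ {v u} → Star c A v u → pairWeight G w v u ≡ 1
      lowered (inj₁ (refl , u∈A)) = proj₂ (proj₁ (A-transferable u∈A))
      lowered (inj₂ (refl , v∈A)) = trans (pairWeight-sym G w _ c) (proj₂ (proj₁ (A-transferable v∈A)))
      disjoint : ∀ {v u} → Star s A v u → ¬ Star c A v u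
      disjoint (inj₁ (v≡s , _)) (inj₁ (v≡c , _)) = s≢c (trans (sym v≡s) v≡c)
      disjoint (inj₁ (_ , u∈A)) (inj₂ (refl , _)) = cover∉A c∈S u∈A
      disjoint (inj₂ (refl , _)) (inj₁ (_ , u∈A)) = cover∉A s∈S u∈A
      disjoint (inj₂ (u≡s , _)) (inj₂ (u≡c , _)) = s≢c (trans (sym u≡s) u≡c)

    private
      not-in-star : ∀ x {v} → ¬ T (A v) → v ≢ x → count (star? x A v) ≡ 0
      not-in-star x {v} v∉A v≢x = trans (count-Star-off-centre x A v≢x) (indicator-no (T? (A v)) v∉A)

      centre-of : ∀ x → ¬ T (A x) → count (star? x A x) ≡ t
      centre-of x x∉A = trans (count-Star-centre x A x∉A) |A|≡t

    centre : col′ c + t ≡ col c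
    centre = begin
      col′ c + t                        ≡⟨ cong (col′ c +_) (centre-of c (cover∉A c∈S)) ⟨
      col′ c + count (star? c A c)      ≡⟨ transferred-colors c ⟩
      col c + count (star? s A c)       ≡⟨ cong (col c +_) (not-in-star s (cover∉A c∈S) (s≢c ∘ sym)) ⟩
      col c + 0                         ≡⟨ +-identityʳ (col c) ⟩
      col c                             ∎
      where open ≡-Reasoning

    source : col′ s ≡ col s + t
    source = begin
      col′ s                            ≡⟨ +-identityʳ (col′ s) ⟨
      col′ s + 0                        ≡⟨ cong (col′ s +_) (not-in-star c (cover∉A s∈S) s≢c) ⟨
      col′ s + count (star? c A s)      ≡⟨ transferred-colors s ⟩
      col s + count (star? s A s)       ≡⟨ cong (col s +_) (centre-of s (cover∉A s∈S)) ⟩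
      col s + t                         ∎
      where open ≡-Reasoning

    unchanged : ∀ {v} → v ≢ c → v ≢ s → col′ v ≡ col v
    unchanged {v} v≢c v≢s = +-cancelʳ-≡ (if A v then 1 else 0) (col′ v) (col v) (begin
      col′ v + (if A v then 1 else 0)   ≡⟨ cong (col′ v +_) (count-Star-off-centre c A v≢c) ⟨
      col′ v + count (star? c A v)      ≡⟨ transferred-colors v ⟩
      col v + count (star? s A v)       ≡⟨ cong (col v +_) (count-Star-off-centre s A v≢s) ⟩
      col v + (if A v then 1 else 0)    ∎)
      where open ≡-Reasoning

    centre-lifted : k < col′ c
    centre-lifted = +-cancelʳ-< t k (col′ c) (subst (k + t <_) (sym centre) room)

    centre≢source : col′ c ≢ col′ s
    centre≢source same = apart (begin
      col s + t + t                     ≡⟨ cong (_+ t) source ⟨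
      col′ s + t                        ≡⟨ cong (_+ t) same ⟨
      col′ c + t                        ≡⟨ centre ⟩
      col c                             ∎)
      where open ≡-Reasoning

    transferred-proper : Proper G transferred
    transferred-proper = proper-after-lifting G cover proper (λ v → (v ≟ c) ⊎-dec (v ≟ s))
      (λ _ v∉D → unchanged (v∉D ∘ inj₁) (v∉D ∘ inj₂)) lifted lifted-apart neighbours-apart
      where
      lifted : ∀ {d} → d ≡ c ⊎ d ≡ s → k < col′ d
      lifted (inj₁ refl) = centre-lifted
      lifted (inj₂ refl) = <-≤-trans k<t (subst (t ≤_) (sym source) (m≤n+m t (col s)))
      lifted-apart : ∀ {d x} → d ≡ c ⊎ d ≡ s → T (S x) → x ≢ d → col′ d ≢ col′ x
      lifted-apart {x = x} (inj₁ refl) x∈S x≢c with x ≟ s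
      ... | yes refl = centre≢source
      ... | no x≢s = λ same → c-avoids x∈S (trans (cong (_+ t) (trans (sym (unchanged x≢c x≢s)) (sym same))) centre)
      lifted-apart {x = x} (inj₂ refl) x∈S x≢s with x ≟ c
      ... | yes refl = centre≢source ∘ sym
      ... | no x≢c = λ same → s-avoids x∈S (trans (sym (unchanged x≢c x≢s)) (trans (sym same) source))
      neighbours-apart : ∀ {x u} → T (S x) → ¬ (x ≡ c ⊎ x ≡ s) → ¬ T (S u) → Adjacent G x u → col′ u ≢ col x
      neighbours-apart {u = u} _ _ u∉S xu same = Proper⇒Adjacent-distinct G proper xu
        (sym (trans (sym (unchanged (outside≢c u∉S) u≢s)) same))
        where
        u≢s : u ≢ s
        u≢s refl = u∉S s∈S

    transferred-energy : energy G transferred < energy G w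
    transferred-energy = Σᶠ-<-two-point (s≢c ∘ sym)
      (λ v v≢c v≢s → ≤-reflexive (cong (λ x → x * x) (unchanged v≢c v≢s)))
      (subst₂ (λ y z → col′ c * col′ c + y * y < z * z + col s * col s) (sym source) centre
        (square-transfer-< (col′ c) t (col s) (<-trans s-small centre-lifted) (≤-<-trans z≤n k<t)))

  droppable? : Decidable Droppable
  droppable? u = ¬? (T? (S u)) ×-dec (pairWeight G w c u ℕ.≟ 1)

  blocks? : ∀ x u → Dec (Blocks x u)
  blocks? x u = adjacent? G u x ×-dec ¬? (x ≟ c) ×-dec (col x + 1 ℕ.≟ col u)

  free? : Decidable Free
  free? u = droppable? u ×-dec all? (λ x → ¬? (blocks? x u))

  Blocked₀ : V → V → Set
  Blocked₀ s u = Transferable s u × col s + 1 ≡ col u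

  blocked₀? : ∀ s → Decidable (Blocked₀ s)
  blocked₀? s u = (droppable? u ×-dec adjacent? G s u ×-dec (pairWeight G w s u ℕ.≟ 0)) ×-dec (col s + 1 ℕ.≟ col u)

  Blocked₁ : V → V → Set
  Blocked₁ s u = ¬ T (S u) × pairWeight G w s u ≡ 1 × col s + 1 ≡ col u

  blocked₁? : ∀ s → Decidable (Blocked₁ s)
  blocked₁? s u = ¬? (T? (S u)) ×-dec (pairWeight G w s u ℕ.≟ 1) ×-dec (col s + 1 ℕ.≟ col u)

  centre≤k+droppable : col c ≤ k + count droppable?
  centre≤k+droppable = begin
    col c
      ≡⟨ color≡Σᶠ-pairWeight G w c ⟩
    Σᶠ (pairWeight G w c)
      ≤⟨ Σᶠ-mono-≤ pointwise ⟩
    Σᶠ (λ u → indicator (T? (S u)) + indicator (droppable? u))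
      ≡⟨ Σᶠ-distrib-+ (indicator ∘ T? ∘ S) (indicator ∘ droppable?) ⟩
    k + count droppable?
      ∎
    where
    open ≤-Reasoning
    pointwise : ∀ u → pairWeight G w c u ≤ indicator (T? (S u)) + indicator (droppable? u)
    pointwise u = by-cover (T? (S u))
      where
      by-cover : (u∈S? : Dec (T (S u))) → pairWeight G w c u ≤ indicator u∈S? + indicator (droppable? u)
      by-cover (yes _) = ≤-trans (pairWeight≤1 G w c u) (m≤m+n 1 _)
      by-cover (no u∉S) with n≤1⇒n≡0∨n≡1 (pairWeight≤1 G w c u)
      ... | inj₁ weight≡0 = ≤-trans (≤-reflexive weight≡0) z≤n
      ... | inj₂ weight≡1 = ≤-reflexive (trans weight≡1 (sym (indicator-yes (droppable? u) (u∉S , weight≡1))))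

  blocker-counted : ∀ {x u} → Droppable u → Blocks x u →
                    1 ≤ indicator (blocked₀? x u) + indicator (blocked₁? x u)
  blocker-counted {x} {u} droppable (ux , _ , x+1≡u) with n≤1⇒n≡0∨n≡1 (pairWeight≤1 G w x u)
  ... | inj₁ weight≡0 = ≤-trans (≤-reflexive (sym (indicator-yes (blocked₀? x u) blocked₀))) (m≤m+n _ _)
    where
    blocked₀ : Blocked₀ x u
    blocked₀ = (droppable , Adjacent-sym G ux , weight≡0) , x+1≡u
  ... | inj₂ weight≡1 = ≤-trans (≤-reflexive (sym (indicator-yes (blocked₁? x u) blocked₁))) (m≤n+m _ _)
    where
    blocked₁ : Blocked₁ x u
    blocked₁ = proj₁ droppable , weight≡1 , x+1≡u

  droppable≤free+blocked :
    count droppable? ≤ count free? + Σᶠ (λ s → count (blocked₀? s) + count (blocked₁? s))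
  droppable≤free+blocked = begin
    count droppable?
      ≤⟨ Σᶠ-mono-≤ pointwise ⟩
    Σᶠ (λ u → indicator (free? u) + Σᶠ (λ s → blocked s u))
      ≡⟨ Σᶠ-distrib-+ (indicator ∘ free?) (λ u → Σᶠ (λ s → blocked s u)) ⟩
    count free? + Σᶠ (λ u → Σᶠ (λ s → blocked s u))
      ≡⟨ cong (count free? +_) (Σᶠ-comm (λ u s → blocked s u)) ⟩
    count free? + Σᶠ (λ s → Σᶠ (blocked s))
      ≡⟨ cong (count free? +_) (Σᶠ-cong λ s → Σᶠ-distrib-+ (indicator ∘ blocked₀? s) (indicator ∘ blocked₁? s)) ⟩
    count free? + Σᶠ (λ s → count (blocked₀? s) + count (blocked₁? s))
      ∎
    where
    open ≤-Reasoning
    blocked : V → V → ℕ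
    blocked s u = indicator (blocked₀? s u) + indicator (blocked₁? s u)
    pointwise : ∀ u → indicator (droppable? u) ≤ indicator (free? u) + Σᶠ (λ s → blocked s u)
    pointwise u = by-cases (free? u) (droppable? u)
      where
      by-cases : (free : Dec (Free u)) (droppable : Dec (Droppable u)) →
                 indicator droppable ≤ indicator free + Σᶠ (λ s → blocked s u)
      by-cases (yes _) droppable = ≤-trans (indicator≤1 droppable) (m≤m+n 1 _)
      by-cases (no _) (no _) = z≤n
      by-cases (no not-free) (yes droppable) =
        let x , ¬¬blocks = ¬∀⟶∃¬ (n G) (λ x → ¬ Blocks x u) (λ x → ¬? (blocks? x u)) (not-free ∘ (droppable ,_))
        in ≤-trans (blocker-counted droppable (decidable-stable (blocks? x u) ¬¬blocks)) (f≤Σᶠ (λ s → blocked s u) x)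

  blocked₁≤k : ∀ s → count (blocked₁? s) ≤ k
  blocked₁≤k s with any? (blocked₁? s)
  ... | no none = ≤-trans (≤-reflexive (count-empty (blocked₁? s) (λ u b → none (u , b)))) z≤n
  ... | yes (u , u∉S , _ , s+1≡u) = begin
    count (blocked₁? s)     ≤⟨ Σᶠ-mono-≤ counted-in-weight ⟩
    Σᶠ (pairWeight G w s)   ≡⟨ color≡Σᶠ-pairWeight G w s ⟨
    col s                   ≤⟨ m≤m+n (col s) 1 ⟩
    col s + 1               ≡⟨ s+1≡u ⟩
    col u                   ≤⟨ color-outside-cover G cover w u∉S ⟩
    k                       ∎
    where
    open ≤-Reasoning
    counted-in-weight : ∀ v → indicator (blocked₁? s v) ≤ pairWeight G w s v
    counted-in-weight v = by-cases (blocked₁? s v)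
      where
      by-cases : (b : Dec (Blocked₁ s v)) → indicator b ≤ pairWeight G w s v
      by-cases (yes (_ , weight≡1 , _)) = ≤-reflexive (sym weight≡1)
      by-cases (no _) = z≤n

  blocked-outside-cover : ∀ s → ¬ T (S s) → count (blocked₀? s) + count (blocked₁? s) ≡ 0
  blocked-outside-cover s s∉S = cong₂ _+_
    (count-empty (blocked₀? s) λ where _ (((u∉S , _) , su , _) , _) → s∉S (neighbour-in-cover u∉S su))
    (count-empty (blocked₁? s) λ where
      _ (u∉S , weight≡1 , _) →
        s∉S (neighbour-in-cover u∉S (pairWeight-positive⇒Adjacent G (≤-reflexive (sym weight≡1)))))

  LandsOn : ℕ → Set
  LandsOn t = ∃ λ x → T (S x) × col x + t ≡ col c

  landsOn? : Decidable LandsOn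
  landsOn? t = any? λ x → T? (S x) ×-dec (col x + t ℕ.≟ col c)

  few-landings : ∀ b r → count (λ (j : Fin r) → landsOn? (b + toℕ j)) ≤ k
  few-landings b r = count-∃-unique≤size S (λ x (j : Fin r) → col x + (b + toℕ j) ℕ.≟ col c)
    λ x lands₁ lands₂ → offset-injective b (+-cancelˡ-≡ (col x) _ _ (trans lands₁ (sym lands₂)))

  Reaches : ℕ → ℕ → Set
  Reaches a t = ∃ λ x → T (S x) × col x ≡ a + t

  reaches? : ∀ a → Decidable (Reaches a)
  reaches? a t = any? λ x → T? (S x) ×-dec (col x ℕ.≟ a + t)

  few-reaches : ∀ a b r → count (λ (j : Fin r) → reaches? a (b + toℕ j)) ≤ k
  few-reaches a b r = count-∃-unique≤size S (λ x (j : Fin r) → col x ℕ.≟ a + (b + toℕ j))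
    λ x reaches₁ reaches₂ → offset-injective b (+-cancelˡ-≡ a _ _ (trans (sym reaches₁) reaches₂))

  by-lowering : k < count free? → LowerEnergy
  by-lowering many-free = lower-with (unforbidden-offset k 1 landsOn? (few-landings 1 (suc k)))
    where
    lower-with : (∃ λ t → 1 ≤ t × t ≤ suc k × ¬ LandsOn t) → LowerEnergy
    lower-with (t , t>0 , t≤1+k , ¬lands) =
      let A , A-free , |A|≡t = select free? t (≤-trans t≤1+k many-free)
          open Lowering A (A-free _) t |A|≡t t>0
            (≤-<-trans (offset-room k>0 (≤-trans t≤1+k (m≤m+n (suc k) _))) c-large)
            (λ x∈S lands → ¬lands (_ , x∈S , lands))
      in lowered , lowered-proper , lowered-energy

  Obstructs : ℕ → ℕ → Set
  Obstructs a t = (a + t + t ≡ col c) ⊎ (Reaches a t ⊎ LandsOn t)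

  obstructs? : ∀ a → Decidable (Obstructs a)
  obstructs? a t = (a + t + t ℕ.≟ col c) ⊎-dec (reaches? a t ⊎-dec landsOn? t)

  few-obstructions : ∀ a b r → count (λ (j : Fin r) → obstructs? a (b + toℕ j)) ≤ suc (k + k)
  few-obstructions a b r = begin
    count (λ (j : Fin r) → obstructs? a (b + toℕ j))  ≤⟨ count-∪ meets? (reach? ∪? land?) ⟩
    count meets? + count (reach? ∪? land?)     ≤⟨ +-mono-≤ (count≤1 meets? meets-once) (count-∪ reach? land?) ⟩
    1 + (count reach? + count land?)           ≤⟨ +-monoʳ-≤ 1 (+-mono-≤ (few-reaches a b r) (few-landings b r)) ⟩
    1 + (k + k)                                ∎
    where
    open ≤-Reasoning
    reach? : (j : Fin r) → Dec (Reaches a (b + toℕ j))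
    reach? j = reaches? a (b + toℕ j)
    land? : (j : Fin r) → Dec (LandsOn (b + toℕ j))
    land? j = landsOn? (b + toℕ j)
    meets? : (j : Fin r) → Dec (a + (b + toℕ j) + (b + toℕ j) ≡ col c)
    meets? j = a + (b + toℕ j) + (b + toℕ j) ℕ.≟ col c
    meets-once : ∀ {i j} → a + (b + toℕ i) + (b + toℕ i) ≡ col c → a + (b + toℕ j) + (b + toℕ j) ≡ col c → i ≡ j
    meets-once {i} {j} meets₁ meets₂ = offset-injective b (double-injective (+-cancelˡ-≡ a _ _ (begin-equality
      a + ((b + toℕ i) + (b + toℕ i))   ≡⟨ +-assoc a _ _ ⟨
      a + (b + toℕ i) + (b + toℕ i)     ≡⟨ trans meets₁ (sym meets₂) ⟩
      a + (b + toℕ j) + (b + toℕ j)     ≡⟨ +-assoc a _ _ ⟩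
      a + ((b + toℕ j) + (b + toℕ j))   ∎)))

  -- t must exceed k and dodge at most 2k + 1 obstructed values, so 2k + 2 candidates k+1, …, 3k+2 suffice.
  transfer-threshold : ℕ
  transfer-threshold = suc k + suc (k + k)

  blocking-source : ∀ {s u} → Blocked₀ s u → T (S s) × col s < k
  blocking-source {s} {u} (((u∉S , _) , su , _) , s+1≡u) =
    neighbour-in-cover u∉S su ,
    subst (_≤ k) (+-comm (col s) 1) (subst (_≤ k) (sym s+1≡u) (color-outside-cover G cover w u∉S))

  by-transfer : ∀ s → transfer-threshold ≤ count (blocked₀? s) → LowerEnergy
  by-transfer s many = transfer-with
    (blocking-source (proj₂ (count-satisfiable (blocked₀? s) (≤-trans (s≤s z≤n) many))))
    (unforbidden-offset (suc (k + k)) (suc k) (obstructs? (col s))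
                        (few-obstructions (col s) (suc k) (suc (suc (k + k)))))
    where
    transfer-with : T (S s) × col s < k →
                    (∃ λ t → suc k ≤ t × t ≤ transfer-threshold × ¬ Obstructs (col s) t) → LowerEnergy
    transfer-with (s∈S , s-small) (t , k<t , t≤threshold , unobstructed) =
      let A , A-blocked , |A|≡t = select (blocked₀? s) t (≤-trans t≤threshold many)
          open Transfer s s∈S s-small A (λ {v} v∈A → proj₁ (A-blocked v v∈A)) t |A|≡t k<t
            (≤-<-trans (offset-room k>0 t≤threshold) c-large)
            (λ x∈S reaches → unobstructed (inj₂ (inj₁ (_ , x∈S , reaches))))
            (λ x∈S lands → unobstructed (inj₂ (inj₂ (_ , x∈S , lands))))
            (unobstructed ∘ inj₁)
      in transferred , transferred-proper , transferred-energy

  few-free-and-blocked-impossible : count free? ≤ k → (∀ s → count (blocked₀? s) < transfer-threshold) → ⊥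
  few-free-and-blocked-impossible few-free few-blocked = <⇒≱ c-large (begin
    col c
      ≤⟨ centre≤k+droppable ⟩
    k + count droppable?
      ≤⟨ +-monoʳ-≤ k droppable≤free+blocked ⟩
    k + (count free? + Σᶠ (λ s → count (blocked₀? s) + count (blocked₁? s)))
      ≤⟨ +-monoʳ-≤ k (+-mono-≤ few-free (Σᶠ-≤-size S blocked-outside-cover per-vertex)) ⟩
    k + (k + k * (k + suc (k + k) + k))
      ≤⟨ counting-room k ⟩
    bound k
      ∎)
    where
    open ≤-Reasoning
    per-vertex : ∀ s → count (blocked₀? s) + count (blocked₁? s) ≤ k + suc (k + k) + k
    per-vertex s = +-mono-≤ (s≤s⁻¹ (few-blocked s)) (blocked₁≤k s)

  lower-energy : LowerEnergy
  lower-energy with k ℕ.<? count free?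
  ... | yes many-free = by-lowering many-free
  ... | no few-free with any? (λ s → transfer-threshold ℕ.≤? count (blocked₀? s))
  ...   | yes (s , many) = by-transfer s many
  ...   | no none = ⊥-elim (few-free-and-blocked-impossible (≮⇒≥ few-free) λ s → ≰⇒> (none ∘ (s ,_)))

mainTheorem4 : (G : Graph) → NoIsolatedEdges G → (k : ℕ) → VertexCoverNumber G k
    → Σ (Weight G) (λ w → Proper G w)
    → Σ (Weight G) (λ ŵ → Proper G ŵ × (∀ v → color G ŵ v ≤ 8 * k * k + 8 * k))
mainTheorem4 G _ k ((S , cover , refl) , _) (w₀ , proper₀) = descent (energy G) step w₀ proper₀
  where
  step : ∀ w → Proper G w → (∀ v → color G w v ≤ bound k) ⊎ ∃ λ w′ → Proper G w′ × energy G w′ < energy G w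
  step w proper with all? (λ v → color G w v ℕ.≤? bound k)
  ... | yes bounded = inj₁ bounded
  ... | no unbounded =
    let c , c-large = ¬∀⟶∃¬ (n G) (λ v → color G w v ≤ bound k) (λ v → color G w v ℕ.≤? bound k) unbounded
    in inj₂ (Improvement.lower-energy G cover w proper c (≰⇒> c-large))
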